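{- Consider three-player \textsc{Nim} under the normal play convention. Every \textsc{Nim} position that is not of one of the forms $k\cdot *$, $k\cdot * + *n$ or $k\cdot * + *2 + *n$ (with $k\ge 0$ and $n\ge 2$) has outcome $\emptyset$. For the remaining positions the outcome depends only on $k \bmod 3$ and is as follows, where $m\ge 3$: \begin{itemize} \item $o(k\cdot *)$ is $\{\mathbf O,\mathbf P\}$, $\{\mathbf P,\mathbf N\}$, $\{\mathbf N,\mathbf O\}$ for $k\equiv 0,1,2 \pmod 3$ respectively; \item $o(k\cdot *+*2)$ is $\{\mathbf N\}$, $\{\mathbf N,\mathbf O\}$, $\{\mathbf P,\mathbf N\}$ for $k\equiv 0,1,2$; \item $o(k\cdot *+*m)$ is $\{\mathbf N\}$, $\{\mathbf N,\mathbf O\}$, $\{\mathbf N\}$ for $k\equiv 0,1,2$; \item $o(k\cdot *+*2+*2)$ is $\{\mathbf O\}$, $\{\mathbf N\}$, $\{\mathbf N,\mathbf O\}$ for $k\equiv 0,1,2$; \item $o(k\cdot *+*2+*m)$ is $\emptyset$, $\{\mathbf N\}$, $\{\mathbf N,\mathbf O\}$ for $k\equiv 0,1,2$. \end{itemize} In particular, the outcome of a \textsc{Nim} position is determined by the numbers of heaps of size $1$, of size $2$, and of size at least $3$.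
   Context: All games are short impartial games: a game is identified with the finite set of its options (positions reachable in one move), and there are no infinite runs. $G+H$ is the disjunctive sum (a move is a move in exactly one component), $n\cdot G$ is the sum of $n$ copies of $G$, $0=\{\}$, and the nim-heap $*n=\{*0,*1,\dots,*(n-1)\}$ with $*=*1$, $*0=0$. A \textsc{Nim} position is a finite sum of nim-heaps. Three players move in turn; under normal play, the player who cannot move on their turn is the unique loser and the other two players win. The outcome $o(G)\subseteq\{\mathbf N,\mathbf O,\mathbf P\}$ (Next, Other, Previous player) is defined recursively: $\mathbf N\in o(G)$ iff some option $G'$ has $\mathbf P\in o(G')$; $\mathbf O\in o(G)$ iff every option $G'$ has $\mathbf N\in o(G')$; $\mathbf P\in o(G)$ iff every option $G'$ has $\mathbf O\in o(G')$. (Thus $o(G)$ is the set of players having a strategy guaranteeing that they do not lose.) -}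

module Defs where

open import Data.Nat using (ℕ; zero; suc; _≤_)
open import Data.Bool using (Bool; true; false; _∨_; _∧_)
open import Data.List using (List; []; _∷_; _++_; replicate; filter; [_])
open import Data.List.Relation.Binary.Permutation.Propositional using (_↭_)
open import Data.Product using (∃; ∃₂; _×_)
open import Data.Sum using (_⊎_)
open import Relation.Unary using (Decidable)
open import Relation.Nullary using (¬_; ¬?)
open import Data.Nat.Properties using (_≟_)

data Game : Set where
  mk : List Game → Game

zeroG : Game
zeroG = mk []

mutual
  _⊕_ : Game → Game → Game
  G@(mk gs) ⊕ H@(mk hs) = mk (sumL gs H ++ sumR G hs)

  sumL : List Game → Game → List Game
  sumL [] H = []
  sumL (g ∷ gs) H = (g ⊕ H) ∷ sumL gs H

  sumR : Game → List Game → List Game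
  sumR G [] = []
  sumR G (h ∷ hs) = (G ⊕ h) ∷ sumR G hs

infixl 6 _⊕_

_·_ : ℕ → Game → Game
zero · G = zeroG
suc n · G = G ⊕ (n · G)

infixr 7 _·_

heapOpts : ℕ → List Game
heapOpts zero = []
heapOpts (suc n) = heapOpts n ++ [ mk (heapOpts n) ]

heap : ℕ → Game
heap n = mk (heapOpts n)

star : Game
star = heap 1

nim : List ℕ → Game
nim [] = zeroG
nim (h ∷ hs) = heap h ⊕ nim hs

mutual
  isN : Game → Bool
  isN (mk gs) = anyP gs

  isO : Game → Bool
  isO (mk gs) = allN gs

  isP : Game → Bool
  isP (mk gs) = allO gs

  anyP : List Game → Bool
  anyP [] = false
  anyP (g ∷ gs) = isP g ∨ anyP gs

  allN : List Game → Bool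
  allN [] = true
  allN (g ∷ gs) = isN g ∧ allN gs

  allO : List Game → Bool
  allO [] = true
  allO (g ∷ gs) = isO g ∧ allO gs

record Outcome : Set where
  constructor ⟨_,_,_⟩
  field
    hasN : Bool
    hasO : Bool
    hasP : Bool

o : Game → Outcome
o G = ⟨ isN G , isO G , isP G ⟩

∅ʳ sN sO sP sNO sOP sPN : Outcome
∅ʳ  = ⟨ false , false , false ⟩
sN  = ⟨ true  , false , false ⟩
sO  = ⟨ false , true  , false ⟩
sP  = ⟨ false , false , true  ⟩
sNO = ⟨ true  , true  , false ⟩
sOP = ⟨ false , true  , true  ⟩
sPN = ⟨ true  , false , true  ⟩

-- Nonzero heaps of a position (heaps *0 = 0 contribute nothing to a sum,
-- since G + 0 = G as games).
nonzero : List ℕ → List ℕ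
nonzero = filter (λ n → ¬? (n ≟ 0))

SpecialForm : List ℕ → Set
SpecialForm ps =
    (∃ λ k → nonzero ps ↭ replicate k 1)
  ⊎ (∃₂ λ k n → 2 ≤ n × nonzero ps ↭ (replicate k 1 ++ [ n ]))
  ⊎ (∃₂ λ k n → 2 ≤ n × nonzero ps ↭ (replicate k 1 ++ 2 ∷ [ n ]))

module Submission where

-- The outcome of a sum of heaps is determined by its census: the numbers of heaps of size 1,
-- of size 2 and of size at least 3.  Indeed the censuses of the options of a position depend
-- only on its census and on whether it has a heap of size at least 4, which can be reduced
-- to size 3 without changing the census.  So, by induction on positions, o agrees with any
-- table of outcomes of censuses that satisfies the outcome recursion along census moves.
-- For the table of the theorem this is a finite check: the table has period 3 in the number
-- of 1-heaps and is ∅ as soon as there are three 2-heaps or two big heaps.  The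
-- census-preserving move never matters, because every census with a big heap has outcome
-- ∅, {N} or {N,O}, which an extra option of the same outcome does not change.

open import Defs
open import Data.Nat using (ℕ; zero; suc; _+_; _≤_; _<_; _≤?_; _%_; s≤s; z<s; s<s)
open import Data.Nat.Properties using (<⇒≤; ≤-refl; +-comm; +-assoc; +-identityʳ; +-suc; +-monoˡ-<; +-monoʳ-<; m≤n⇒m≤n+o; m≤n⇒m≤o+n)
open import Data.Nat.Induction using (<-wellFounded)
open import Data.Bool using (Bool; true; false; T; _∨_; _∧_)
open import Data.Bool.Properties using (∨-comm; T-∨)
open import Data.Empty using (⊥-elim)
open import Data.Unit using (tt)
open import Data.Product using (_×_; _,_; ∃-syntax)
open import Data.Sum using (_⊎_; inj₁; inj₂)
open import Data.List using (List; []; _∷_; _++_; [_]; map; upTo; replicate; length; filter)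
open import Data.Bool.ListAction using (any; all)
open import Data.List.Properties using (map-++; map-∘; map-cong-local; upTo-∷ʳ; ++-identityʳ)
open import Data.List.Membership.Propositional using (_∈_)
open import Data.List.Membership.Propositional.Properties using (∈-map⁺; ∈-map⁻; ∈-++⁺ˡ; ∈-++⁺ʳ; ∈-++⁻; ∈-upTo⁺; ∈-upTo⁻)
open import Data.List.Relation.Unary.Any using (here; there)
open import Data.List.Relation.Unary.All as All using (All; []; _∷_)
open import Data.List.Relation.Unary.All.Properties using (all-anti-mono; all-filter)
open import Data.List.Relation.Binary.Subset.Propositional using (_⊆_)
import Data.List.Relation.Binary.Subset.Propositional.Properties as ⊆
open import Data.List.Relation.Binary.Permutation.Propositional using (_↭_; prep; ↭-refl; ↭-trans; ↭-sym)
open import Data.List.Relation.Binary.Permutation.Propositional.Properties using (shift; ++⁺ˡ)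
open import Function using (_∘_; id; Equivalence)
open import Induction.WellFounded using (Acc; acc)
open import Relation.Nullary using (¬_)
open import Relation.Binary.PropositionalEquality using (_≡_; refl; sym; trans; cong; cong₂; subst)
open Relation.Binary.PropositionalEquality.≡-Reasoning

open Outcome

private
  variable
    a b c : ℕ
    f g : Bool

options : Game → List Game
options (mk gs) = gs

outcomeFrom : List Outcome → Outcome
outcomeFrom os = ⟨ any hasP os , all hasN os , all hasO os ⟩

o-options : ∀ G → o G ≡ outcomeFrom (map o (options G))
o-options (mk [])       = refl
o-options (mk (g ∷ gs)) =
  cong (λ r → ⟨ isP g ∨ hasN r , isN g ∧ hasO r , isO g ∧ hasP r ⟩) (o-options (mk gs))

T-injective : ∀ {x y} → (T x → T y) → (T y → T x) → x ≡ y
T-injective {false} {false} _   _   = refl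
T-injective {false} {true}  _   y⇒x = ⊥-elim (y⇒x tt)
T-injective {true}  {false} x⇒y _   = ⊥-elim (x⇒y tt)
T-injective {true}  {true}  _   _   = refl

outcomeFrom-cong : ∀ {xs ys} → xs ⊆ ys → ys ⊆ xs → outcomeFrom xs ≡ outcomeFrom ys
outcomeFrom-cong xs⊆ys ys⊆xs
  rewrite T-injective (⊆.any⁺ hasP xs⊆ys) (⊆.any⁺ hasP ys⊆xs)
        | T-injective (all-anti-mono hasN ys⊆xs) (all-anti-mono hasN xs⊆ys)
        | T-injective (all-anti-mono hasO ys⊆xs) (all-anti-mono hasO xs⊆ys)
        = refl

sumL≡map : ∀ gs H → sumL gs H ≡ map (_⊕ H) gs
sumL≡map []       H = refl
sumL≡map (g ∷ gs) H = cong (g ⊕ H ∷_) (sumL≡map gs H)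

sumR≡map : ∀ G hs → sumR G hs ≡ map (G ⊕_) hs
sumR≡map G []       = refl
sumR≡map G (h ∷ hs) = cong (G ⊕ h ∷_) (sumR≡map G hs)

options-⊕ : ∀ G H → options (G ⊕ H) ≡ map (_⊕ H) (options G) ++ map (G ⊕_) (options H)
options-⊕ G@(mk gs) H@(mk hs) = cong₂ _++_ (sumL≡map gs H) (sumR≡map G hs)

heapOpts-upTo : ∀ n → heapOpts n ≡ map heap (upTo n)
heapOpts-upTo zero    = refl
heapOpts-upTo (suc n) = begin
  heapOpts n ++ [ heap n ]             ≡⟨ cong (_++ [ heap n ]) (heapOpts-upTo n) ⟩
  map heap (upTo n) ++ map heap [ n ]  ≡⟨ map-++ heap (upTo n) [ n ] ⟨
  map heap (upTo n ++ [ n ])           ≡⟨ cong (map heap) (upTo-∷ʳ n) ⟩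
  map heap (upTo (suc n))              ∎

data Pos : Set where
  ⋆_  : ℕ → Pos
  _⊞_ : Pos → Pos → Pos

infix  8 ⋆_
infixl 6 _⊞_

⟦_⟧ : Pos → Game
⟦ ⋆ n ⟧   = heap n
⟦ p ⊞ q ⟧ = ⟦ p ⟧ ⊕ ⟦ q ⟧

moves : Pos → List Pos
moves (⋆ n)   = map ⋆_ (upTo n)
moves (p ⊞ q) = map (_⊞ q) (moves p) ++ map (p ⊞_) (moves q)

options-⟦⟧ : ∀ p → options ⟦ p ⟧ ≡ map ⟦_⟧ (moves p)
options-⟦⟧ (⋆ n) = trans (heapOpts-upTo n) (map-∘ (upTo n))
options-⟦⟧ (p ⊞ q) = begin
  options (⟦ p ⟧ ⊕ ⟦ q ⟧)
    ≡⟨ options-⊕ ⟦ p ⟧ ⟦ q ⟧ ⟩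
  map (_⊕ ⟦ q ⟧) (options ⟦ p ⟧) ++ map (⟦ p ⟧ ⊕_) (options ⟦ q ⟧)
    ≡⟨ cong₂ (λ ps qs → map (_⊕ ⟦ q ⟧) ps ++ map (⟦ p ⟧ ⊕_) qs) (options-⟦⟧ p) (options-⟦⟧ q) ⟩
  map (_⊕ ⟦ q ⟧) (map ⟦_⟧ (moves p)) ++ map (⟦ p ⟧ ⊕_) (map ⟦_⟧ (moves q))
    ≡⟨ cong₂ _++_ (map-∘ (moves p)) (map-∘ (moves q)) ⟨
  map (λ p′ → ⟦ p′ ⊞ q ⟧) (moves p) ++ map (λ q′ → ⟦ p ⊞ q′ ⟧) (moves q)
    ≡⟨ cong₂ _++_ (map-∘ (moves p)) (map-∘ (moves q)) ⟩
  map ⟦_⟧ (map (_⊞ q) (moves p)) ++ map ⟦_⟧ (map (p ⊞_) (moves q))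
    ≡⟨ map-++ ⟦_⟧ (map (_⊞ q) (moves p)) (map (p ⊞_) (moves q)) ⟨
  map ⟦_⟧ (moves (p ⊞ q))
    ∎

∈-moves-⋆ : ∀ n {r} → r ∈ moves (⋆ n) → ∃[ j ] j < n × r ≡ ⋆ j
∈-moves-⋆ n r∈ with ∈-map⁻ ⋆_ r∈
... | j , j∈ , refl = j , ∈-upTo⁻ j∈ , refl

∈-moves-⊞ : ∀ p q {r} → r ∈ moves (p ⊞ q) →
            (∃[ p′ ] p′ ∈ moves p × r ≡ p′ ⊞ q) ⊎ (∃[ q′ ] q′ ∈ moves q × r ≡ p ⊞ q′)
∈-moves-⊞ p q r∈ with ∈-++⁻ (map (_⊞ q) (moves p)) r∈
... | inj₁ r∈ˡ = inj₁ (∈-map⁻ (_⊞ q) r∈ˡ)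
... | inj₂ r∈ʳ = inj₂ (∈-map⁻ (p ⊞_) r∈ʳ)

size : Pos → ℕ
size (⋆ n)   = n
size (p ⊞ q) = size p + size q

moves-size : ∀ p {r} → r ∈ moves p → size r < size p
moves-size (⋆ n) r∈ with ∈-moves-⋆ n r∈
... | j , j<n , refl = j<n
moves-size (p ⊞ q) r∈ with ∈-moves-⊞ p q r∈
... | inj₁ (p′ , p′∈ , refl) = +-monoˡ-< (size q) (moves-size p p′∈)
... | inj₂ (q′ , q′∈ , refl) = +-monoʳ-< (size p) (moves-size q q′∈)

record Census : Set where
  constructor census
  field
    ones twos bigs : ℕ

open Census

_⊹_ : Census → Census → Census
x ⊹ y = census (ones x + ones y) (twos x + twos y) (bigs x + bigs y)

infixl 6 _⊹_

⊹-comm : ∀ x y → x ⊹ y ≡ y ⊹ x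
⊹-comm x y rewrite +-comm (ones x) (ones y) | +-comm (twos x) (twos y) | +-comm (bigs x) (bigs y) = refl

⊹-assoc : ∀ x y z → x ⊹ y ⊹ z ≡ x ⊹ (y ⊹ z)
⊹-assoc x y z
  rewrite +-assoc (ones x) (ones y) (ones z) | +-assoc (twos x) (twos y) (twos z) | +-assoc (bigs x) (bigs y) (bigs z)
  = refl

⊹-identityʳ : ∀ x → x ⊹ census 0 0 0 ≡ x
⊹-identityʳ x rewrite +-identityʳ (ones x) | +-identityʳ (twos x) | +-identityʳ (bigs x) = refl

heapCensus : ℕ → Census
heapCensus 0                   = census 0 0 0
heapCensus 1                   = census 1 0 0
heapCensus 2                   = census 0 1 0
heapCensus (suc (suc (suc _))) = census 0 0 1

huge : ℕ → Bool
huge (suc (suc (suc (suc _)))) = true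
huge _                         = false

censusOf : Pos → Census
censusOf (⋆ n)   = heapCensus n
censusOf (p ⊞ q) = censusOf p ⊹ censusOf q

anyHuge : Pos → Bool
anyHuge (⋆ n)   = huge n
anyHuge (p ⊞ q) = anyHuge p ∨ anyHuge q

anyHuge⇒bigs : ∀ p → T (anyHuge p) → 0 < bigs (censusOf p)
anyHuge⇒bigs (⋆ suc (suc (suc (suc _)))) _ = z<s
anyHuge⇒bigs (p ⊞ q) h with Equivalence.to T-∨ h
... | inj₁ hp = m≤n⇒m≤n+o (bigs (censusOf q)) (anyHuge⇒bigs p hp)
... | inj₂ hq = m≤n⇒m≤o+n (bigs (censusOf p)) (anyHuge⇒bigs q hq)

data CensusMove : Census → Census → Set where
  1→0   : CensusMove (census (suc a) b c) (census a b c)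
  2→0   : CensusMove (census a (suc b) c) (census a b c)
  2→1   : CensusMove (census a (suc b) c) (census (suc a) b c)
  big→0 : CensusMove (census a b (suc c)) (census a b c)
  big→1 : CensusMove (census a b (suc c)) (census (suc a) b c)
  big→2 : CensusMove (census a b (suc c)) (census a (suc b) c)

data Move (f : Bool) (x : Census) : Census → Set where
  change   : ∀ {t} → CensusMove x t → Move f x t
  huge→big : T f → Move f x x

fromOne fromTwo fromBig : Census → List Census
fromOne (census (suc a) b c) = [ census a b c ]
fromOne (census zero    b c) = []
fromTwo (census a (suc b) c) = census a b c ∷ census (suc a) b c ∷ []
fromTwo (census a zero    c) = []
fromBig (census a b (suc c)) = census a b c ∷ census (suc a) b c ∷ census a (suc b) c ∷ []
fromBig (census a b zero)    = []

censusMoves : Bool → Census → List Census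
censusMoves true  x = x ∷ censusMoves false x
censusMoves false x = fromOne x ++ fromTwo x ++ fromBig x

CensusMove⇒∈ : ∀ {x t} → CensusMove x t → t ∈ censusMoves false x
CensusMove⇒∈         1→0   = here refl
CensusMove⇒∈ {x}     2→0   = ∈-++⁺ʳ (fromOne x) (here refl)
CensusMove⇒∈ {x}     2→1   = ∈-++⁺ʳ (fromOne x) (there (here refl))
CensusMove⇒∈ {x}     big→0 = ∈-++⁺ʳ (fromOne x) (∈-++⁺ʳ (fromTwo x) (here refl))
CensusMove⇒∈ {x}     big→1 = ∈-++⁺ʳ (fromOne x) (∈-++⁺ʳ (fromTwo x) (there (here refl)))
CensusMove⇒∈ {x}     big→2 = ∈-++⁺ʳ (fromOne x) (∈-++⁺ʳ (fromTwo x) (there (there (here refl))))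

fromOne-move : ∀ x {t} → t ∈ fromOne x → CensusMove x t
fromOne-move (census (suc a) b c) (here refl) = 1→0

fromTwo-move : ∀ x {t} → t ∈ fromTwo x → CensusMove x t
fromTwo-move (census a (suc b) c) (here refl)         = 2→0
fromTwo-move (census a (suc b) c) (there (here refl)) = 2→1

fromBig-move : ∀ x {t} → t ∈ fromBig x → CensusMove x t
fromBig-move (census a b (suc c)) (here refl)                 = big→0
fromBig-move (census a b (suc c)) (there (here refl))         = big→1
fromBig-move (census a b (suc c)) (there (there (here refl))) = big→2

∈⇒CensusMove : ∀ x {t} → t ∈ censusMoves false x → CensusMove x t
∈⇒CensusMove x t∈ with ∈-++⁻ (fromOne x) t∈
... | inj₁ t∈₁ = fromOne-move x t∈₁
... | inj₂ t∈₂ with ∈-++⁻ (fromTwo x) t∈₂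
...   | inj₁ t∈₂′ = fromTwo-move x t∈₂′
...   | inj₂ t∈₃  = fromBig-move x t∈₃

Move⇒∈ : ∀ {x t} → Move f x t → t ∈ censusMoves f x
Move⇒∈ {true}  (change m)   = there (CensusMove⇒∈ m)
Move⇒∈ {false} (change m)   = CensusMove⇒∈ m
Move⇒∈ {true}  (huge→big _) = here refl

∈⇒Move : ∀ f x {t} → t ∈ censusMoves f x → Move f x t
∈⇒Move true  x (here refl) = huge→big tt
∈⇒Move true  x (there t∈)  = change (∈⇒CensusMove x t∈)
∈⇒Move false x t∈          = change (∈⇒CensusMove x t∈)

CensusMove-⊹ʳ : ∀ {x t} y → CensusMove x t → CensusMove (x ⊹ y) (t ⊹ y)
CensusMove-⊹ʳ y 1→0   = 1→0
CensusMove-⊹ʳ y 2→0   = 2→0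
CensusMove-⊹ʳ y 2→1   = 2→1
CensusMove-⊹ʳ y big→0 = big→0
CensusMove-⊹ʳ y big→1 = big→1
CensusMove-⊹ʳ y big→2 = big→2

Move-⊹ʳ : ∀ {x t} g y → Move f x t → Move (f ∨ g) (x ⊹ y) (t ⊹ y)
Move-⊹ʳ g y (change m)    = change (CensusMove-⊹ʳ y m)
Move-⊹ʳ g y (huge→big hf) = huge→big (Equivalence.from T-∨ (inj₁ hf))

Move-⊹ˡ : ∀ {y t} f x → Move g y t → Move (f ∨ g) (x ⊹ y) (x ⊹ t)
Move-⊹ˡ {g} {y} {t} f x m rewrite ∨-comm f g | ⊹-comm x y | ⊹-comm x t = Move-⊹ʳ f x m

CensusMove-⊹⁻ : ∀ x y {t} → CensusMove (x ⊹ y) t →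
                (∃[ t′ ] CensusMove x t′ × t ≡ t′ ⊹ y) ⊎ (∃[ t′ ] CensusMove y t′ × t ≡ x ⊹ t′)
CensusMove-⊹⁻ x y m = split x y m refl
  where
  split : ∀ x y {z t} → CensusMove z t → z ≡ x ⊹ y →
          (∃[ t′ ] CensusMove x t′ × t ≡ t′ ⊹ y) ⊎ (∃[ t′ ] CensusMove y t′ × t ≡ x ⊹ t′)
  split (census (suc a) b c) y                 1→0   refl = inj₁ (_ , 1→0 , refl)
  split (census zero b c)    (census a′ b′ c′) 1→0   refl = inj₂ (_ , 1→0 , refl)
  split (census a (suc b) c) y                 2→0   refl = inj₁ (_ , 2→0 , refl)
  split (census a zero c)    (census a′ b′ c′) 2→0   refl = inj₂ (_ , 2→0 , refl)
  split (census a (suc b) c) y                 2→1   refl = inj₁ (_ , 2→1 , refl)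
  split (census a zero c)    (census a′ _ c′)  (2→1 {b = b″}) refl =
    inj₂ (_ , 2→1 , cong (λ n → census n b″ (c + c′)) (sym (+-suc a a′)))
  split (census a b (suc c)) y                 big→0 refl = inj₁ (_ , big→0 , refl)
  split (census a b zero)    (census a′ b′ c′) big→0 refl = inj₂ (_ , big→0 , refl)
  split (census a b (suc c)) y                 big→1 refl = inj₁ (_ , big→1 , refl)
  split (census a b zero)    (census a′ b′ _)  (big→1 {c = c″}) refl =
    inj₂ (_ , big→1 , cong (λ n → census n (b + b′) c″) (sym (+-suc a a′)))
  split (census a b (suc c)) y                 big→2 refl = inj₁ (_ , big→2 , refl)
  split (census a b zero)    (census a′ b′ _)  (big→2 {c = c″}) refl =
    inj₂ (_ , big→2 , cong (λ n → census (a + a′) n c″) (sym (+-suc b b′)))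

Move-⊹⁻ : ∀ x y {t} → Move (f ∨ g) (x ⊹ y) t →
          (∃[ t′ ] Move f x t′ × t ≡ t′ ⊹ y) ⊎ (∃[ t′ ] Move g y t′ × t ≡ x ⊹ t′)
Move-⊹⁻ x y (change m) with CensusMove-⊹⁻ x y m
... | inj₁ (t′ , m′ , eq) = inj₁ (t′ , change m′ , eq)
... | inj₂ (t′ , m′ , eq) = inj₂ (t′ , change m′ , eq)
Move-⊹⁻ x y (huge→big h) with Equivalence.to T-∨ h
... | inj₁ hf = inj₁ (x , huge→big hf , refl)
... | inj₂ hg = inj₂ (y , huge→big hg , refl)

heap-move : ∀ {j n} → j < n → Move (huge n) (heapCensus n) (heapCensus j)
heap-move {n = 1}                 z<s             = change 1→0
heap-move {n = 2}                 z<s             = change 2→0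
heap-move {n = 2}                 (s<s z<s)       = change 2→1
heap-move {n = suc (suc (suc _))} z<s             = change big→0
heap-move {n = suc (suc (suc _))} (s<s z<s)       = change big→1
heap-move {n = suc (suc (suc _))} (s<s (s<s z<s)) = change big→2
heap-move {suc (suc (suc _))} {suc (suc (suc (suc _)))} _ = huge→big tt

heap-move⁻ : ∀ n {t} → Move (huge n) (heapCensus n) t → ∃[ j ] j < n × heapCensus j ≡ t
heap-move⁻ 1                         (change 1→0)   = 0 , z<s , refl
heap-move⁻ 2                         (change 2→0)   = 0 , z<s , refl
heap-move⁻ 2                         (change 2→1)   = 1 , s<s z<s , refl
heap-move⁻ (suc (suc (suc _)))       (change big→0) = 0 , z<s , refl
heap-move⁻ (suc (suc (suc _)))       (change big→1) = 1 , s<s z<s , refl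
heap-move⁻ (suc (suc (suc _)))       (change big→2) = 2 , s<s (s<s z<s) , refl
heap-move⁻ (suc (suc (suc (suc _)))) (huge→big _)   = 3 , s<s (s<s (s<s z<s)) , refl

moves-sound : ∀ p {r} → r ∈ moves p → Move (anyHuge p) (censusOf p) (censusOf r)
moves-sound (⋆ n) r∈ with ∈-moves-⋆ n r∈
... | j , j<n , refl = heap-move j<n
moves-sound (p ⊞ q) r∈ with ∈-moves-⊞ p q r∈
... | inj₁ (p′ , p′∈ , refl) = Move-⊹ʳ (anyHuge q) (censusOf q) (moves-sound p p′∈)
... | inj₂ (q′ , q′∈ , refl) = Move-⊹ˡ (anyHuge p) (censusOf p) (moves-sound q q′∈)

moves-complete : ∀ p {t} → Move (anyHuge p) (censusOf p) t → ∃[ r ] r ∈ moves p × censusOf r ≡ t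
moves-complete (⋆ n) m with heap-move⁻ n m
... | j , j<n , eq = ⋆ j , ∈-map⁺ ⋆_ (∈-upTo⁺ j<n) , eq
moves-complete (p ⊞ q) m with Move-⊹⁻ {anyHuge p} {anyHuge q} (censusOf p) (censusOf q) m
... | inj₁ (t′ , m′ , refl) =
  let p′ , p′∈ , eq = moves-complete p m′
  in  p′ ⊞ q , ∈-++⁺ˡ (∈-map⁺ (_⊞ q) p′∈) , cong (_⊹ censusOf q) eq
... | inj₂ (t′ , m′ , refl) =
  let q′ , q′∈ , eq = moves-complete q m′
  in  p ⊞ q′ , ∈-++⁺ʳ (map (_⊞ q) (moves p)) (∈-map⁺ (p ⊞_) q′∈) , cong (censusOf p ⊹_) eq

censusOf-moves-⊆ : ∀ p → map censusOf (moves p) ⊆ censusMoves (anyHuge p) (censusOf p)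
censusOf-moves-⊆ p t∈ with ∈-map⁻ censusOf t∈
... | r , r∈ , refl = Move⇒∈ (moves-sound p r∈)

censusOf-moves-⊇ : ∀ p → censusMoves (anyHuge p) (censusOf p) ⊆ map censusOf (moves p)
censusOf-moves-⊇ p t∈ with moves-complete p (∈⇒Move (anyHuge p) (censusOf p) t∈)
... | r , r∈ , refl = ∈-map⁺ censusOf r∈

cyclic3 : ∀ {A : Set} → A → A → A → ℕ → A
cyclic3 x y z 0                   = x
cyclic3 x y z 1                   = y
cyclic3 x y z 2                   = z
cyclic3 x y z (suc (suc (suc k))) = cyclic3 x y z k

cyclic3-elim : ∀ {A : Set} (P : A → Set) {x y z} → P x → P y → P z → ∀ k → P (cyclic3 x y z k)
cyclic3-elim P px py pz 0                   = px
cyclic3-elim P px py pz 1                   = py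
cyclic3-elim P px py pz 2                   = pz
cyclic3-elim P px py pz (suc (suc (suc k))) = cyclic3-elim P px py pz k

cyclic3-% : ∀ {A : Set} (x y z : A) k → cyclic3 x y z k ≡ cyclic3 x y z (k % 3)
cyclic3-% x y z 0                   = refl
cyclic3-% x y z 1                   = refl
cyclic3-% x y z 2                   = refl
cyclic3-% x y z (suc (suc (suc k))) = cyclic3-% x y z k

nimOutcome : Census → Outcome
nimOutcome (census a 0 0) = cyclic3 sOP sPN sNO a
nimOutcome (census a 1 0) = cyclic3 sN  sNO sPN a
nimOutcome (census a 0 1) = cyclic3 sN  sNO sN  a
nimOutcome (census a 2 0) = cyclic3 sO  sN  sNO a
nimOutcome (census a 1 1) = cyclic3 ∅ʳ  sN  sNO a
nimOutcome _              = ∅ʳ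

ones-induction : {P : ℕ → Set} → P 0 → P 1 → P 2 → P 3 → (∀ a → P (1 + a) → P (4 + a)) →
                 ∀ a → P a
ones-induction     p0 p1 p2 p3 step 0 = p0
ones-induction     p0 p1 p2 p3 step 1 = p1
ones-induction     p0 p1 p2 p3 step 2 = p2
ones-induction     p0 p1 p2 p3 step 3 = p3
ones-induction {P} p0 p1 p2 p3 step (suc (suc (suc (suc a)))) =
  step a (ones-induction {P} p0 p1 p2 p3 step (suc a))

-- An evaluation: twos and bigs are split just far enough for both sides to compute, and the
-- step of ones-induction is definitional because the table has period 3 in the ones.
nimOutcome-changes : ∀ b c a →
  nimOutcome (census a b c) ≡ outcomeFrom (map nimOutcome (censusMoves false (census a b c)))
nimOutcome-changes 0                         0                   = ones-induction refl refl refl refl (λ _ → id)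
nimOutcome-changes 0                         1                   = ones-induction refl refl refl refl (λ _ → id)
nimOutcome-changes 0                         2                   = ones-induction refl refl refl refl (λ _ → id)
nimOutcome-changes 0                         (suc (suc (suc _))) = ones-induction refl refl refl refl (λ _ → id)
nimOutcome-changes 1                         0                   = ones-induction refl refl refl refl (λ _ → id)
nimOutcome-changes 1                         1                   = ones-induction refl refl refl refl (λ _ → id)
nimOutcome-changes 1                         2                   = ones-induction refl refl refl refl (λ _ → id)
nimOutcome-changes 1                         (suc (suc (suc _))) = ones-induction refl refl refl refl (λ _ → id)
nimOutcome-changes 2                         0                   = ones-induction refl refl refl refl (λ _ → id)
nimOutcome-changes 2                         1                   = ones-induction refl refl refl refl (λ _ → id)
nimOutcome-changes 2                         2                   = ones-induction refl refl refl refl (λ _ → id)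
nimOutcome-changes 2                         (suc (suc (suc _))) = ones-induction refl refl refl refl (λ _ → id)
nimOutcome-changes 3                         0                   = ones-induction refl refl refl refl (λ _ → id)
nimOutcome-changes 3                         1                   = ones-induction refl refl refl refl (λ _ → id)
nimOutcome-changes 3                         2                   = ones-induction refl refl refl refl (λ _ → id)
nimOutcome-changes 3                         (suc (suc (suc _))) = ones-induction refl refl refl refl (λ _ → id)
nimOutcome-changes (suc (suc (suc (suc _)))) 0                   = ones-induction refl refl refl refl (λ _ → id)
nimOutcome-changes (suc (suc (suc (suc _)))) 1                   = ones-induction refl refl refl refl (λ _ → id)
nimOutcome-changes (suc (suc (suc (suc _)))) 2                   = ones-induction refl refl refl refl (λ _ → id)
nimOutcome-changes (suc (suc (suc (suc _)))) (suc (suc (suc _))) = ones-induction refl refl refl refl (λ _ → id)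

withOption : Outcome → Outcome → Outcome
withOption t u = ⟨ hasP t ∨ hasN u , hasN t ∧ hasO u , hasO t ∧ hasP u ⟩

SelfAbsorbing : Outcome → Set
SelfAbsorbing u = withOption u u ≡ u

nimOutcome-absorbing : ∀ a b c → SelfAbsorbing (nimOutcome (census a b (suc c)))
nimOutcome-absorbing a 0                   0       = cyclic3-elim SelfAbsorbing refl refl refl a
nimOutcome-absorbing a 0                   (suc _) = refl
nimOutcome-absorbing a 1                   0       = cyclic3-elim SelfAbsorbing refl refl refl a
nimOutcome-absorbing a 1                   (suc _) = refl
nimOutcome-absorbing a 2                   _       = refl
nimOutcome-absorbing a (suc (suc (suc _))) _       = refl

outcomeFrom-∷-absorbing : ∀ {u os} → u ≡ outcomeFrom os → SelfAbsorbing u → u ≡ outcomeFrom (u ∷ os)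
outcomeFrom-∷-absorbing refl absorbing = sym absorbing

nimOutcome-censusMoves : ∀ f x → (T f → 0 < bigs x) →
                         nimOutcome x ≡ outcomeFrom (map nimOutcome (censusMoves f x))
nimOutcome-censusMoves false (census a b c)       _ = nimOutcome-changes b c a
nimOutcome-censusMoves true  (census a b (suc c)) _ =
  outcomeFrom-∷-absorbing {os = map nimOutcome (censusMoves false (census a b (suc c)))}
    (nimOutcome-changes b (suc c) a) (nimOutcome-absorbing a b c)
nimOutcome-censusMoves true  (census a b zero)    h with h tt
... | ()

o-⟦⟧-moves : ∀ p → o ⟦ p ⟧ ≡ outcomeFrom (map (o ∘ ⟦_⟧) (moves p))
o-⟦⟧-moves p = begin
  o ⟦ p ⟧                                   ≡⟨ o-options ⟦ p ⟧ ⟩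
  outcomeFrom (map o (options ⟦ p ⟧))       ≡⟨ cong (outcomeFrom ∘ map o) (options-⟦⟧ p) ⟩
  outcomeFrom (map o (map ⟦_⟧ (moves p)))   ≡⟨ cong outcomeFrom (map-∘ (moves p)) ⟨
  outcomeFrom (map (o ∘ ⟦_⟧) (moves p))     ∎

nimOutcome-recursion : ∀ p → outcomeFrom (map (nimOutcome ∘ censusOf) (moves p)) ≡ nimOutcome (censusOf p)
nimOutcome-recursion p = begin
  outcomeFrom (map (nimOutcome ∘ censusOf) (moves p))
    ≡⟨ cong outcomeFrom (map-∘ (moves p)) ⟩
  outcomeFrom (map nimOutcome (map censusOf (moves p)))
    ≡⟨ outcomeFrom-cong (⊆.map⁺ nimOutcome (censusOf-moves-⊆ p)) (⊆.map⁺ nimOutcome (censusOf-moves-⊇ p)) ⟩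
  outcomeFrom (map nimOutcome (censusMoves (anyHuge p) (censusOf p)))
    ≡⟨ nimOutcome-censusMoves (anyHuge p) (censusOf p) (anyHuge⇒bigs p) ⟨
  nimOutcome (censusOf p)
    ∎

o-⟦⟧≡nimOutcome : ∀ p → o ⟦ p ⟧ ≡ nimOutcome (censusOf p)
o-⟦⟧≡nimOutcome p = go p (<-wellFounded (size p))
  where
  go : ∀ p → Acc _<_ (size p) → o ⟦ p ⟧ ≡ nimOutcome (censusOf p)
  go p (acc rec) = begin
    o ⟦ p ⟧                                             ≡⟨ o-⟦⟧-moves p ⟩
    outcomeFrom (map (o ∘ ⟦_⟧) (moves p))               ≡⟨ cong outcomeFrom (map-cong-local ih) ⟩
    outcomeFrom (map (nimOutcome ∘ censusOf) (moves p)) ≡⟨ nimOutcome-recursion p ⟩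
    nimOutcome (censusOf p)                             ∎
    where
    ih : All (λ r → o ⟦ r ⟧ ≡ nimOutcome (censusOf r)) (moves p)
    ih = All.tabulate λ {r} r∈ → go r (rec (moves-size p r∈))

stars : ℕ → Pos
stars zero    = ⋆ 0
stars (suc k) = ⋆ 1 ⊞ stars k

⟦stars⟧ : ∀ k → ⟦ stars k ⟧ ≡ k · star
⟦stars⟧ zero    = refl
⟦stars⟧ (suc k) = cong (star ⊕_) (⟦stars⟧ k)

censusOf-stars⊹ : ∀ k b c → censusOf (stars k) ⊹ census 0 b c ≡ census k b c
censusOf-stars⊹ zero    b c = refl
censusOf-stars⊹ (suc k) b c = cong (census 1 0 0 ⊹_) (censusOf-stars⊹ k b c)

o-stars⊞ : ∀ {G} k p b c → ⟦ p ⟧ ≡ G → censusOf p ≡ censusOf (stars k) ⊹ census 0 b c →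
           o G ≡ nimOutcome (census k b c)
o-stars⊞ k p b c refl eq = trans (o-⟦⟧≡nimOutcome p) (cong nimOutcome (trans eq (censusOf-stars⊹ k b c)))

o-k* : ∀ k → o (k · star) ≡ nimOutcome (census k 0 0)
o-k* k = o-stars⊞ k (stars k) 0 0 (⟦stars⟧ k) (sym (⊹-identityʳ _))

o-k*+2 : ∀ k → o (k · star ⊕ heap 2) ≡ nimOutcome (census k 1 0)
o-k*+2 k = o-stars⊞ k (stars k ⊞ ⋆ 2) 1 0 (cong (_⊕ heap 2) (⟦stars⟧ k)) refl

o-k*+big : ∀ k m → 3 ≤ m → o (k · star ⊕ heap m) ≡ nimOutcome (census k 0 1)
o-k*+big k m@(suc (suc (suc _))) (s≤s (s≤s (s≤s _))) =
  o-stars⊞ k (stars k ⊞ ⋆ m) 0 1 (cong (_⊕ heap m) (⟦stars⟧ k)) refl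

o-k*+2+2 : ∀ k → o (k · star ⊕ heap 2 ⊕ heap 2) ≡ nimOutcome (census k 2 0)
o-k*+2+2 k =
  o-stars⊞ k (stars k ⊞ ⋆ 2 ⊞ ⋆ 2) 2 0 (cong (λ G → G ⊕ heap 2 ⊕ heap 2) (⟦stars⟧ k))
    (⊹-assoc (censusOf (stars k)) (heapCensus 2) (heapCensus 2))

o-k*+2+big : ∀ k m → 3 ≤ m → o (k · star ⊕ heap 2 ⊕ heap m) ≡ nimOutcome (census k 1 1)
o-k*+2+big k m@(suc (suc (suc _))) (s≤s (s≤s (s≤s _))) =
  o-stars⊞ k (stars k ⊞ ⋆ 2 ⊞ ⋆ m) 1 1 (cong (λ G → G ⊕ heap 2 ⊕ heap m) (⟦stars⟧ k))
    (⊹-assoc (censusOf (stars k)) (heapCensus 2) (heapCensus m))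

residues : ∀ {A : Set} {u x y z : A} k → u ≡ cyclic3 x y z k →
           (k % 3 ≡ 0 → u ≡ x) × (k % 3 ≡ 1 → u ≡ y) × (k % 3 ≡ 2 → u ≡ z)
residues {A} {u} {x} {y} {z} k eq = at , at , at
  where
  at : ∀ {r} → k % 3 ≡ r → u ≡ cyclic3 x y z r
  at refl = trans eq (cyclic3-% x y z k)

nimPos : List ℕ → Pos
nimPos []       = ⋆ 0
nimPos (n ∷ ns) = ⋆ n ⊞ nimPos ns

⟦nimPos⟧ : ∀ ps → ⟦ nimPos ps ⟧ ≡ nim ps
⟦nimPos⟧ []       = refl
⟦nimPos⟧ (n ∷ ns) = cong (heap n ⊕_) (⟦nimPos⟧ ns)

bigHeaps : List ℕ → List ℕ
bigHeaps = filter (3 ≤?_)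

length-bigHeaps : ∀ ps → length (bigHeaps ps) ≡ bigs (censusOf (nimPos ps))
length-bigHeaps []                       = refl
length-bigHeaps (0 ∷ ps)                 = length-bigHeaps ps
length-bigHeaps (1 ∷ ps)                 = length-bigHeaps ps
length-bigHeaps (2 ∷ ps)                 = length-bigHeaps ps
length-bigHeaps (suc (suc (suc _)) ∷ ps) = cong suc (length-bigHeaps ps)

nonzero-↭ : ∀ ps → let x = censusOf (nimPos ps) in
            nonzero ps ↭ replicate (ones x) 1 ++ replicate (twos x) 2 ++ bigHeaps ps
nonzero-↭ []       = ↭-refl
nonzero-↭ (0 ∷ ps) = nonzero-↭ ps
nonzero-↭ (1 ∷ ps) = prep 1 (nonzero-↭ ps)
nonzero-↭ (2 ∷ ps) =
  ↭-trans (prep 2 (nonzero-↭ ps)) (↭-sym (shift 2 ones₁ (twos₂ ++ bigHeaps ps)))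
  where
  x = censusOf (nimPos ps)
  ones₁ = replicate (ones x) 1
  twos₂ = replicate (twos x) 2
nonzero-↭ (n@(suc (suc (suc _))) ∷ ps) =
  ↭-trans (prep n (nonzero-↭ ps))
  (↭-trans (↭-sym (shift n ones₁ (twos₂ ++ bigHeaps ps)))
           (++⁺ˡ ones₁ (↭-sym (shift n twos₂ (bigHeaps ps)))))
  where
  x = censusOf (nimPos ps)
  ones₁ = replicate (ones x) 1
  twos₂ = replicate (twos x) 2

nimOutcome-nonSpecial : ∀ {ps} a b hs → All (3 ≤_) hs →
                        nonzero ps ↭ replicate a 1 ++ replicate b 2 ++ hs →
                        ¬ SpecialForm ps → nimOutcome (census a b (length hs)) ≡ ∅ʳ
nimOutcome-nonSpecial {ps} a 0 [] _ σ ¬sf =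
  ⊥-elim (¬sf (inj₁ (a , subst (nonzero ps ↭_) (++-identityʳ _) σ)))
nimOutcome-nonSpecial a 0 (n ∷ []) (3≤n ∷ []) σ ¬sf = ⊥-elim (¬sf (inj₂ (inj₁ (a , n , <⇒≤ 3≤n , σ))))
nimOutcome-nonSpecial a 1 []       _          σ ¬sf = ⊥-elim (¬sf (inj₂ (inj₁ (a , 2 , ≤-refl , σ))))
nimOutcome-nonSpecial a 1 (n ∷ []) (3≤n ∷ []) σ ¬sf = ⊥-elim (¬sf (inj₂ (inj₂ (a , n , <⇒≤ 3≤n , σ))))
nimOutcome-nonSpecial a 2 []       _          σ ¬sf = ⊥-elim (¬sf (inj₂ (inj₂ (a , 2 , ≤-refl , σ))))
nimOutcome-nonSpecial a 2                   (_ ∷ [])    _ _ _ = refl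
nimOutcome-nonSpecial a 0                   (_ ∷ _ ∷ _) _ _ _ = refl
nimOutcome-nonSpecial a 1                   (_ ∷ _ ∷ _) _ _ _ = refl
nimOutcome-nonSpecial a 2                   (_ ∷ _ ∷ _) _ _ _ = refl
nimOutcome-nonSpecial a (suc (suc (suc _))) _           _ _ _ = refl

o-nonSpecial : ∀ ps → ¬ SpecialForm ps → o (nim ps) ≡ ∅ʳ
o-nonSpecial ps ¬sf = begin
  o (nim ps)                                     ≡⟨ cong o (⟦nimPos⟧ ps) ⟨
  o ⟦ nimPos ps ⟧                                ≡⟨ o-⟦⟧≡nimOutcome (nimPos ps) ⟩
  nimOutcome (census (ones x) (twos x) (bigs x))
    ≡⟨ cong (nimOutcome ∘ census (ones x) (twos x)) (length-bigHeaps ps) ⟨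
  nimOutcome (census (ones x) (twos x) (length (bigHeaps ps)))
    ≡⟨ nimOutcome-nonSpecial {ps} (ones x) (twos x) (bigHeaps ps) (all-filter (3 ≤?_) ps) (nonzero-↭ ps) ¬sf ⟩
  ∅ʳ
    ∎
  where x = censusOf (nimPos ps)

mainTheorem1 :
    (∀ (ps : List ℕ) → ¬ SpecialForm ps → o (nim ps) ≡ ∅ʳ)
  × (∀ (k : ℕ) →
        (k % 3 ≡ 0 → o (k · star) ≡ sOP)
      × (k % 3 ≡ 1 → o (k · star) ≡ sPN)
      × (k % 3 ≡ 2 → o (k · star) ≡ sNO))
  × (∀ (k : ℕ) →
        (k % 3 ≡ 0 → o (k · star ⊕ heap 2) ≡ sN)
      × (k % 3 ≡ 1 → o (k · star ⊕ heap 2) ≡ sNO)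
      × (k % 3 ≡ 2 → o (k · star ⊕ heap 2) ≡ sPN))
  × (∀ (k m : ℕ) → 3 ≤ m →
        (k % 3 ≡ 0 → o (k · star ⊕ heap m) ≡ sN)
      × (k % 3 ≡ 1 → o (k · star ⊕ heap m) ≡ sNO)
      × (k % 3 ≡ 2 → o (k · star ⊕ heap m) ≡ sN))
  × (∀ (k : ℕ) →
        (k % 3 ≡ 0 → o (k · star ⊕ heap 2 ⊕ heap 2) ≡ sO)
      × (k % 3 ≡ 1 → o (k · star ⊕ heap 2 ⊕ heap 2) ≡ sN)
      × (k % 3 ≡ 2 → o (k · star ⊕ heap 2 ⊕ heap 2) ≡ sNO))
  × (∀ (k m : ℕ) → 3 ≤ m →
        (k % 3 ≡ 0 → o (k · star ⊕ heap 2 ⊕ heap m) ≡ ∅ʳ)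
      × (k % 3 ≡ 1 → o (k · star ⊕ heap 2 ⊕ heap m) ≡ sN)
      × (k % 3 ≡ 2 → o (k · star ⊕ heap 2 ⊕ heap m) ≡ sNO))
mainTheorem1 =
    o-nonSpecial
  , (λ k → residues k (o-k* k))
  , (λ k → residues k (o-k*+2 k))
  , (λ k m 3≤m → residues k (o-k*+big k m 3≤m))
  , (λ k → residues k (o-k*+2+2 k))
  , (λ k m 3≤m → residues k (o-k*+2+big k m 3≤m))
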